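{- Let $n\ge1$. Partition and orient the edges of $G_{n,3}$ as follows, where $w=(x,y,z)$ ranges over all vertices and $e_1,e_2,e_3$ are the unit vectors: the edge from $w$ to $w+e_1$ is directed from $w$ to $w+e_1$ and belongs to $Z$ if $x+y+z\equiv-1\pmod{4^n}$ and to $X$ otherwise; the edge from $w$ to $w+e_2$ is directed from $w$ to $w+e_2$ and belongs to $X$ if $x+y+z\equiv-1\pmod{4^n}$ and to $Y$ otherwise; the edge from $w$ to $w+e_3$ is directed from $w$ to $w+e_3$ and belongs to $Y$ if $x+y+z\equiv-1\pmod{4^n}$ and to $Z$ otherwise. Then the edge set of $G_{n,3}$ decomposes into $3\cdot4^n$ pairwise edge-disjoint directed cycles, each with $4^{2n}$ edges and each contained in one of $X,Y,Z$.
   Context: $G_{n,3}$ is the Cartesian product of three copies of the cycle $C_{4^n}$: vertices are triples $(x,y,z)$ with entries in $\mathbb{Z}/4^n\mathbb{Z}$, two vertices being adjacent iff they differ in exactly one coordinate, by $\pm1\pmod{4^n}$. -}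

module Defs where

open import Data.Nat using (ℕ; _+_; _*_; _∸_; _^_; _≤_; NonZero)
open import Data.Nat.Properties using (m^n≢0)
open import Data.Nat.DivMod using (_mod_; _%_)
open import Data.Fin using (Fin; toℕ; zero; suc)
open import Data.Product using (Σ; ∃; _×_; _,_; proj₁; proj₂)
open import Relation.Binary.PropositionalEquality using (_≡_)
open import Relation.Nullary using (¬_; Dec; yes; no)
open import Data.Nat using (_≟_)
import Data.Nat as ℕ

inc4 : (k : ℕ) → Fin (4 ^ k) → Fin (4 ^ k)
inc4 k a = _mod_ (ℕ.suc (toℕ a)) (4 ^ k) {{m^n≢0 4 k}}

-- vertices of G_{n,3}: triples in (Z/4^n)^3
Vertex : ℕ → Set
Vertex n = Fin (4 ^ n) × Fin (4 ^ n) × Fin (4 ^ n)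

step : (n : ℕ) → Vertex n → Fin 3 → Vertex n
step n (x , y , z) zero             = (inc4 n x , y , z)
step n (x , y , z) (suc zero)       = (x , inc4 n y , z)
step n (x , y , z) (suc (suc zero)) = (x , y , inc4 n z)

-- an edge of G_{n,3}: the edge {w, w+e_i}, oriented from w to w+e_i
Edge : ℕ → Set
Edge n = Vertex n × Fin 3

source : (n : ℕ) → Edge n → Vertex n
source n (w , i) = w

target : (n : ℕ) → Edge n → Vertex n
target n (w , i) = step n w i

data Colour : Set where
  X Y Z : Colour

SumIsMinusOne : (n : ℕ) → Vertex n → Set
SumIsMinusOne n (x , y , z) =
  _%_ (toℕ x + toℕ y + toℕ z) (4 ^ n) {{m^n≢0 4 n}} ≡ 4 ^ n ∸ 1

sumIsMinusOne? : (n : ℕ) → (w : Vertex n) → Dec (SumIsMinusOne n w)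
sumIsMinusOne? n (x , y , z) =
  _%_ (toℕ x + toℕ y + toℕ z) (4 ^ n) {{m^n≢0 4 n}} ≟ 4 ^ n ∸ 1

colourOf : (n : ℕ) → Edge n → Colour
colourOf n (w , i) with sumIsMinusOne? n w
colourOf n (w , zero)          | yes _ = Z
colourOf n (w , zero)          | no  _ = X
colourOf n (w , suc zero)      | yes _ = X
colourOf n (w , suc zero)      | no  _ = Y
colourOf n (w , suc (suc zero)) | yes _ = Y
colourOf n (w , suc (suc zero)) | no  _ = Z

IsDirectedCycle : (n L : ℕ) .{{_ : NonZero L}} → (Fin L → Edge n) → Set
IsDirectedCycle n L c =
  (∀ k → target n (c k) ≡ source n (c (_mod_ (ℕ.suc (toℕ k)) L)))
  × (∀ k l → source n (c k) ≡ source n (c l) → k ≡ l)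

CycleDecomposition : (n N L : ℕ) .{{_ : NonZero L}} → Set
CycleDecomposition n N L =
  Σ (Fin N → Fin L → Edge n) λ cyc →
      (∀ j → IsDirectedCycle n L (cyc j))
    × (∀ j → ∃ λ (col : Colour) → ∀ k → colourOf n (cyc j k) ≡ col)
    × (∀ j k j′ k′ → cyc j k ≡ cyc j′ k′ → (j , k) ≡ (j′ , k′))
    × (∀ (e : Edge n) → ∃ λ j → ∃ λ k → cyc j k ≡ e)

-- Write q = 4ⁿ. In the layer z = j, follow the X-edges and record a vertex by the residues of
-- s = x + y + j and of y: an X-edge adds e₁ and so raises s, except where s ≡ -1, where it adds e₂,
-- so s wraps to 0 while y goes up by one. Hence (s, y) runs through all q² values like a two-digit
-- base-q odometer, and the X-edges of each layer form a single cycle of length q². The coordinate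
-- rotation (x, y, z) ↦ (z, x, y) preserves the sum, sends e₁, e₂, e₃ to e₂, e₃, e₁ and X to Y to Z,
-- which gives the Y- and Z-cycles in the layers x = j and y = j.

module Submission where

open import Defs
open import Data.Nat using (ℕ; zero; suc; pred; _+_; _*_; _∸_; _^_; _≤_; _<_; NonZero)
open import Data.Nat.Properties
open import Data.Nat.DivMod
open import Data.Nat.Divisibility using (divides)
open import Data.Nat.Tactic.RingSolver using (solve-∀)
open import Data.Fin using (Fin; toℕ; fromℕ<; zero; suc; remQuot; combine)
open import Data.Fin.Properties using (toℕ-injective; toℕ-fromℕ<; toℕ<n; remQuot-combine; combine-remQuot)
open import Data.Product using (_×_; _,_; proj₁; proj₂; uncurry)
open import Function using (_∘_)
open import Relation.Binary.PropositionalEquality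
open import Relation.Nullary using (yes; no)
open ≡-Reasoning

m+n+o≡n+o+m : ∀ m n o → m + n + o ≡ n + o + m
m+n+o≡n+o+m = solve-∀

m+n+o≡m+o+n : ∀ m n o → m + n + o ≡ m + o + n
m+n+o≡m+o+n = solve-∀

[m%n+o]%n≡[m+o]%n : ∀ m o n .{{_ : NonZero n}} → (m % n + o) % n ≡ (m + o) % n
[m%n+o]%n≡[m+o]%n m o n = begin
  (m % n + o) % n         ≡⟨ %-distribˡ-+ (m % n) o n ⟩
  (m % n % n + o % n) % n ≡⟨ cong (λ u → (u + o % n) % n) (m%n%n≡m%n m n) ⟩
  (m % n + o % n) % n     ≡⟨ %-distribˡ-+ m o n ⟨
  (m + o) % n             ∎

[m+o%n]%n≡[m+o]%n : ∀ m o n .{{_ : NonZero n}} → (m + o % n) % n ≡ (m + o) % n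
[m+o%n]%n≡[m+o]%n m o n = begin
  (m + o % n) % n ≡⟨ cong (_% n) (+-comm m (o % n)) ⟩
  (o % n + m) % n ≡⟨ [m%n+o]%n≡[m+o]%n o m n ⟩
  (o + m) % n     ≡⟨ cong (_% n) (+-comm o m) ⟩
  (m + o) % n     ∎

module Residues (q : ℕ) .{{_ : NonZero q}} where

  infixl 6 _⊖_
  _⊖_ : ℕ → ℕ → ℕ
  a ⊖ c = (a + (q ∸ c % q)) % q

  ⊖<q : ∀ a c → a ⊖ c < q
  ⊖<q a c = m%n<n _ q

  [m+n%q+[q∸n%q]]%q≡m%q : ∀ a c → (a + c % q + (q ∸ c % q)) % q ≡ a % q
  [m+n%q+[q∸n%q]]%q≡m%q a c = begin
    (a + c % q + (q ∸ c % q)) % q   ≡⟨ cong (_% q) (+-assoc a (c % q) _) ⟩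
    (a + (c % q + (q ∸ c % q))) % q ≡⟨ cong (λ u → (a + u) % q) (m+[n∸m]≡n (m%n≤n c q)) ⟩
    (a + q) % q                     ≡⟨ [m+n]%n≡m%n a q ⟩
    a % q                           ∎

  [m⊖n+n]%q≡m%q : ∀ a c → (a ⊖ c + c) % q ≡ a % q
  [m⊖n+n]%q≡m%q a c = begin
    (a ⊖ c + c) % q                 ≡⟨ [m%n+o]%n≡[m+o]%n _ c q ⟩
    (a + (q ∸ c % q) + c) % q       ≡⟨ [m+o%n]%n≡[m+o]%n _ c q ⟨
    (a + (q ∸ c % q) + c % q) % q   ≡⟨ cong (_% q) (m+n+o≡m+o+n a (q ∸ c % q) (c % q)) ⟩
    (a + c % q + (q ∸ c % q)) % q   ≡⟨ [m+n%q+[q∸n%q]]%q≡m%q a c ⟩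
    a % q                           ∎

  ⊖-unique : ∀ {x} a c → x < q → (x + c) % q ≡ a % q → x ≡ a ⊖ c
  ⊖-unique {x} a c x<q x+c≡a = begin
    x                                   ≡⟨ m<n⇒m%n≡m x<q ⟨
    x % q                               ≡⟨ [m+n%q+[q∸n%q]]%q≡m%q x c ⟨
    (x + c % q + (q ∸ c % q)) % q       ≡⟨ [m%n+o]%n≡[m+o]%n _ _ q ⟨
    ((x + c % q) % q + (q ∸ c % q)) % q ≡⟨ cong (λ u → (u + (q ∸ c % q)) % q) x+c%q≡a ⟩
    (a % q + (q ∸ c % q)) % q           ≡⟨ [m%n+o]%n≡[m+o]%n a _ q ⟩
    a ⊖ c                               ∎
    where
    x+c%q≡a : (x + c % q) % q ≡ a % q
    x+c%q≡a = trans ([m+o%n]%n≡[m+o]%n x c q) x+c≡a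

  ⊖-cong : ∀ {a a′ c c′} → a % q ≡ a′ % q → c % q ≡ c′ % q → a ⊖ c ≡ a′ ⊖ c′
  ⊖-cong {a} {a′} {c} {c′} a≡a′ c≡c′ = begin
    a ⊖ c                       ≡⟨ [m%n+o]%n≡[m+o]%n a _ q ⟨
    (a % q + (q ∸ c % q)) % q   ≡⟨ cong₂ (λ u v → (u + (q ∸ v)) % q) a≡a′ c≡c′ ⟩
    (a′ % q + (q ∸ c′ % q)) % q ≡⟨ [m%n+o]%n≡[m+o]%n a′ _ q ⟩
    a′ ⊖ c′                     ∎

  suc-⊖ : ∀ a c → suc (a ⊖ c) % q ≡ suc a ⊖ c
  suc-⊖ a c = [m+o%n]%n≡[m+o]%n 1 (a + (q ∸ c % q)) q

  suc-⊖-suc : ∀ a c → suc a ⊖ suc c ≡ a ⊖ c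
  suc-⊖-suc a c = sym (⊖-unique (suc a) (suc c) (⊖<q a c) (begin
    (a ⊖ c + suc c) % q       ≡⟨ cong (_% q) (+-suc (a ⊖ c) c) ⟩
    (1 + (a ⊖ c + c)) % q     ≡⟨ [m+o%n]%n≡[m+o]%n 1 (a ⊖ c + c) q ⟨
    (1 + (a ⊖ c + c) % q) % q ≡⟨ cong (λ u → (1 + u) % q) ([m⊖n+n]%q≡m%q a c) ⟩
    (1 + a % q) % q           ≡⟨ [m+o%n]%n≡[m+o]%n 1 a q ⟩
    suc a % q                 ∎))

  [m+n*q]/q≡n : ∀ {s} h → s < q → (s + h * q) / q ≡ h
  [m+n*q]/q≡n {s} h s<q = begin
    (s + h * q) / q   ≡⟨ +-distrib-/-∣ʳ s (divides h refl) ⟩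
    s / q + h * q / q ≡⟨ cong₂ _+_ (m<n⇒m/n≡0 s<q) (m*n/n≡m h q) ⟩
    h                 ∎

  1+m≡1+m%q+m/q*q : ∀ t → suc t ≡ suc (t % q) + t / q * q
  1+m≡1+m%q+m/q*q t = cong suc (m≡m%n+[m/n]*n t q)

  [1+m]/q≡m/q : ∀ t → t % q ≢ q ∸ 1 → suc t / q ≡ t / q
  [1+m]/q≡m/q t t%q≢q-1 = begin
    suc t / q                     ≡⟨ cong (_/ q) (1+m≡1+m%q+m/q*q t) ⟩
    (suc (t % q) + t / q * q) / q ≡⟨ [m+n*q]/q≡n (t / q) 1+t%q<q ⟩
    t / q                         ∎
    where
    1+t%q<q : suc (t % q) < q
    1+t%q<q = ≤∧≢⇒< (m%n<n t q) (λ 1+t%q≡q → t%q≢q-1 (cong pred 1+t%q≡q))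

  [1+m]/q≡1+m/q : ∀ t → t % q ≡ q ∸ 1 → suc t / q ≡ suc (t / q)
  [1+m]/q≡1+m/q t t%q≡q-1 = begin
    suc t / q                     ≡⟨ cong (_/ q) (1+m≡1+m%q+m/q*q t) ⟩
    (suc (t % q) + t / q * q) / q ≡⟨ cong (λ u → (u + t / q * q) / q) 1+t%q≡q ⟩
    suc (t / q) * q / q           ≡⟨ m*n/n≡m (suc (t / q)) q ⟩
    suc (t / q)                   ∎
    where
    1+t%q≡q : suc (t % q) ≡ q
    1+t%q≡q = trans (cong suc t%q≡q-1) (suc-pred q)

  m%q+m/q%q*q≡m : ∀ {t} → t < q * q → t % q + t / q % q * q ≡ t
  m%q+m/q%q*q≡m {t} t<q*q = begin
    t % q + t / q % q * q ≡⟨ cong (λ h → t % q + h * q) (m<n⇒m%n≡m (m<n*o⇒m/o<n t<q*q)) ⟩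
    t % q + t / q * q     ≡⟨ m≡m%n+[m/n]*n t q ⟨
    t                     ∎

module Torus (n : ℕ) where

  q : ℕ
  q = 4 ^ n

  instance
    q≢0 : NonZero q
    q≢0 = m^n≢0 4 n

    q*q≢0 : NonZero (q * q)
    q*q≢0 = m*n≢0 q q

  open Residues q

  coordSum : Vertex n → ℕ
  coordSum (x , y , z) = toℕ x + toℕ y + toℕ z

  toℕ-inc4 : ∀ a → toℕ (inc4 n a) ≡ suc (toℕ a) % q
  toℕ-inc4 a = toℕ-fromℕ< _

  toℕ-mod : ∀ m → toℕ (m mod q) ≡ m % q
  toℕ-mod m = toℕ-fromℕ< _

  _⊖ᶠ_ : ℕ → ℕ → Fin q
  a ⊖ᶠ c = fromℕ< (⊖<q a c)

  toℕ-⊖ᶠ : ∀ a c → toℕ (a ⊖ᶠ c) ≡ a ⊖ c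
  toℕ-⊖ᶠ a c = toℕ-fromℕ< (⊖<q a c)

  -- The t-th vertex of the X-cycle in the layer z = j: its coordinate sum is ≡ t and its y is ≡ t / q.
  odometer : Fin q → ℕ → Vertex n
  odometer j t = t ⊖ᶠ (t / q + toℕ j) , (t / q) mod q , j

  coordSum-odometer : ∀ j t → coordSum (odometer j t) % q ≡ t % q
  coordSum-odometer j t = begin
    (toℕ (t ⊖ᶠ c) + toℕ ((t / q) mod q) + toℕ j) % q
      ≡⟨ cong₂ (λ x h → (x + h + toℕ j) % q) (toℕ-⊖ᶠ t c) (toℕ-mod (t / q)) ⟩
    (t ⊖ c + t / q % q + toℕ j) % q ≡⟨ cong (_% q) (m+n+o≡m+o+n (t ⊖ c) _ (toℕ j)) ⟩
    (t ⊖ c + toℕ j + t / q % q) % q ≡⟨ [m+o%n]%n≡[m+o]%n (t ⊖ c + toℕ j) (t / q) q ⟩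
    (t ⊖ c + toℕ j + t / q) % q     ≡⟨ cong (_% q) (m+n+o≡m+o+n (t ⊖ c) (toℕ j) (t / q)) ⟩
    (t ⊖ c + t / q + toℕ j) % q     ≡⟨ cong (_% q) (+-assoc (t ⊖ c) (t / q) (toℕ j)) ⟩
    (t ⊖ c + c) % q                 ≡⟨ [m⊖n+n]%q≡m%q t c ⟩
    t % q                           ∎
    where c = t / q + toℕ j

  odometer-suc : ∀ j t → t % q ≢ q ∸ 1 → step n (odometer j t) zero ≡ odometer j (suc t)
  odometer-suc j t t%q≢q-1 =
    cong₂ _,_ (toℕ-injective x-suc) (cong (λ h → h mod q , j) (sym ([1+m]/q≡m/q t t%q≢q-1)))
    where
    x-suc : toℕ (inc4 n (t ⊖ᶠ (t / q + toℕ j))) ≡ toℕ (suc t ⊖ᶠ (suc t / q + toℕ j))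
    x-suc = begin
      toℕ (inc4 n (t ⊖ᶠ (t / q + toℕ j)))  ≡⟨ toℕ-inc4 _ ⟩
      suc (toℕ (t ⊖ᶠ (t / q + toℕ j))) % q ≡⟨ cong (λ x → suc x % q) (toℕ-⊖ᶠ t _) ⟩
      suc (t ⊖ (t / q + toℕ j)) % q        ≡⟨ suc-⊖ t _ ⟩
      suc t ⊖ (t / q + toℕ j)              ≡⟨ cong (λ h → suc t ⊖ (h + toℕ j)) ([1+m]/q≡m/q t t%q≢q-1) ⟨
      suc t ⊖ (suc t / q + toℕ j)          ≡⟨ toℕ-⊖ᶠ (suc t) _ ⟨
      toℕ (suc t ⊖ᶠ (suc t / q + toℕ j))   ∎

  odometer-suc-carry : ∀ j t → t % q ≡ q ∸ 1 → step n (odometer j t) (suc zero) ≡ odometer j (suc t)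
  odometer-suc-carry j t t%q≡q-1 = cong₂ _,_ (toℕ-injective x-suc) (cong (_, j) (toℕ-injective y-suc))
    where
    x-suc : toℕ (t ⊖ᶠ (t / q + toℕ j)) ≡ toℕ (suc t ⊖ᶠ (suc t / q + toℕ j))
    x-suc = begin
      toℕ (t ⊖ᶠ (t / q + toℕ j))         ≡⟨ toℕ-⊖ᶠ t _ ⟩
      t ⊖ (t / q + toℕ j)                ≡⟨ suc-⊖-suc t _ ⟨
      suc t ⊖ suc (t / q + toℕ j)        ≡⟨ cong (λ h → suc t ⊖ (h + toℕ j)) ([1+m]/q≡1+m/q t t%q≡q-1) ⟨
      suc t ⊖ (suc t / q + toℕ j)        ≡⟨ toℕ-⊖ᶠ (suc t) _ ⟨
      toℕ (suc t ⊖ᶠ (suc t / q + toℕ j)) ∎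
    y-suc : toℕ (inc4 n ((t / q) mod q)) ≡ toℕ ((suc t / q) mod q)
    y-suc = begin
      toℕ (inc4 n ((t / q) mod q))   ≡⟨ toℕ-inc4 _ ⟩
      suc (toℕ ((t / q) mod q)) % q  ≡⟨ cong (λ y → suc y % q) (toℕ-mod (t / q)) ⟩
      (1 + t / q % q) % q            ≡⟨ [m+o%n]%n≡[m+o]%n 1 (t / q) q ⟩
      suc (t / q) % q                ≡⟨ cong (_% q) ([1+m]/q≡1+m/q t t%q≡q-1) ⟨
      suc t / q % q                  ≡⟨ toℕ-mod (suc t / q) ⟨
      toℕ ((suc t / q) mod q)        ∎

  odometer-mod : ∀ j t → odometer j (t % (q * q)) ≡ odometer j t
  odometer-mod j t = cong₂ _,_ (toℕ-injective x≡) (cong (_, j) (toℕ-injective y≡))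
    where
    t′ = t % (q * q)
    t′%q≡t%q : t′ % q ≡ t % q
    t′%q≡t%q = m∣n⇒o%n%m≡o%m q (q * q) t (divides q refl)
    t′/q%q≡t/q%q : t′ / q % q ≡ t / q % q
    t′/q%q≡t/q%q = trans (cong (_% q) (m%[n*o]/o≡m/o%n t q q)) (m%n%n≡m%n (t / q) q)
    t′/q+j≡t/q+j : (t′ / q + toℕ j) % q ≡ (t / q + toℕ j) % q
    t′/q+j≡t/q+j = begin
      (t′ / q + toℕ j) % q     ≡⟨ [m%n+o]%n≡[m+o]%n (t′ / q) (toℕ j) q ⟨
      (t′ / q % q + toℕ j) % q ≡⟨ cong (λ h → (h + toℕ j) % q) t′/q%q≡t/q%q ⟩
      (t / q % q + toℕ j) % q  ≡⟨ [m%n+o]%n≡[m+o]%n (t / q) (toℕ j) q ⟩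
      (t / q + toℕ j) % q      ∎
    x≡ : toℕ (t′ ⊖ᶠ (t′ / q + toℕ j)) ≡ toℕ (t ⊖ᶠ (t / q + toℕ j))
    x≡ = begin
      toℕ (t′ ⊖ᶠ (t′ / q + toℕ j)) ≡⟨ toℕ-⊖ᶠ t′ _ ⟩
      t′ ⊖ (t′ / q + toℕ j)        ≡⟨ ⊖-cong t′%q≡t%q t′/q+j≡t/q+j ⟩
      t ⊖ (t / q + toℕ j)          ≡⟨ toℕ-⊖ᶠ t _ ⟨
      toℕ (t ⊖ᶠ (t / q + toℕ j))   ∎
    y≡ : toℕ ((t′ / q) mod q) ≡ toℕ ((t / q) mod q)
    y≡ = trans (toℕ-mod (t′ / q)) (trans t′/q%q≡t/q%q (sym (toℕ-mod (t / q))))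

  layer : Vertex n → Fin q
  layer (_ , _ , z) = z

  position : Vertex n → ℕ
  position (x , y , z) = coordSum (x , y , z) % q + toℕ y * q

  position<q*q : ∀ v → position v < q * q
  position<q*q (x , y , z) = ≤-trans (+-monoˡ-< (toℕ y * q) (m%n<n _ q)) (*-monoˡ-≤ q (toℕ<n y))

  odometer-position : ∀ v → odometer (layer v) (position v) ≡ v
  odometer-position (x , y , z) =
    cong₂ _,_ (toℕ-injective x≡) (cong (_, z) (toℕ-injective y≡))
    where
    p = position (x , y , z)
    p/q≡y : p / q ≡ toℕ y
    p/q≡y = [m+n*q]/q≡n (toℕ y) (m%n<n _ q)
    x+[y+z]≡p : (toℕ x + (toℕ y + toℕ z)) % q ≡ p % q
    x+[y+z]≡p = begin
      (toℕ x + (toℕ y + toℕ z)) % q ≡⟨ cong (_% q) (+-assoc (toℕ x) (toℕ y) (toℕ z)) ⟨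
      coordSum (x , y , z) % q      ≡⟨ m%n%n≡m%n _ q ⟨
      coordSum (x , y , z) % q % q  ≡⟨ [m+kn]%n≡m%n _ (toℕ y) q ⟨
      p % q                         ∎
    x≡ : toℕ (p ⊖ᶠ (p / q + toℕ z)) ≡ toℕ x
    x≡ = begin
      toℕ (p ⊖ᶠ (p / q + toℕ z)) ≡⟨ toℕ-⊖ᶠ p _ ⟩
      p ⊖ (p / q + toℕ z)        ≡⟨ cong (λ h → p ⊖ (h + toℕ z)) p/q≡y ⟩
      p ⊖ (toℕ y + toℕ z)        ≡⟨ ⊖-unique p _ (toℕ<n x) x+[y+z]≡p ⟨
      toℕ x                      ∎
    y≡ : toℕ ((p / q) mod q) ≡ toℕ y
    y≡ = trans (toℕ-mod (p / q)) (trans (cong (_% q) p/q≡y) (m<n⇒m%n≡m (toℕ<n y)))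

  position-odometer : ∀ j {t} → t < q * q → position (odometer j t) ≡ t
  position-odometer j {t} t<q*q = begin
    coordSum (odometer j t) % q + toℕ ((t / q) mod q) * q
      ≡⟨ cong₂ (λ s h → s + h * q) (coordSum-odometer j t) (toℕ-mod (t / q)) ⟩
    t % q + t / q % q * q ≡⟨ m%q+m/q%q*q≡m t<q*q ⟩
    t                     ∎

  rotate : Fin 3 → Vertex n → Vertex n
  rotate zero             (x , y , z) = x , y , z
  rotate (suc zero)       (x , y , z) = z , x , y
  rotate (suc (suc zero)) (x , y , z) = y , z , x

  unrotate : Fin 3 → Vertex n → Vertex n
  unrotate zero             (x , y , z) = x , y , z
  unrotate (suc zero)       (x , y , z) = y , z , x
  unrotate (suc (suc zero)) (x , y , z) = z , x , y

  rotate-unrotate : ∀ i w → rotate i (unrotate i w) ≡ w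
  rotate-unrotate zero             w = refl
  rotate-unrotate (suc zero)       w = refl
  rotate-unrotate (suc (suc zero)) w = refl

  unrotate-rotate : ∀ i v → unrotate i (rotate i v) ≡ v
  unrotate-rotate zero             v = refl
  unrotate-rotate (suc zero)       v = refl
  unrotate-rotate (suc (suc zero)) v = refl

  coordSum-rotate : ∀ i v → coordSum (rotate i v) ≡ coordSum v
  coordSum-rotate zero             v           = refl
  coordSum-rotate (suc zero)       (x , y , z) = m+n+o≡n+o+m (toℕ z) (toℕ x) (toℕ y)
  coordSum-rotate (suc (suc zero)) (x , y , z) = sym (m+n+o≡n+o+m (toℕ x) (toℕ y) (toℕ z))

  next : Fin 3 → Fin 3
  next zero             = suc zero
  next (suc zero)       = suc (suc zero)
  next (suc (suc zero)) = zero

  step-rotate : ∀ i v → step n (rotate i v) i ≡ rotate i (step n v zero)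
  step-rotate zero             v = refl
  step-rotate (suc zero)       v = refl
  step-rotate (suc (suc zero)) v = refl

  step-rotate-next : ∀ i v → step n (rotate i v) (next i) ≡ rotate i (step n v (suc zero))
  step-rotate-next zero             v = refl
  step-rotate-next (suc zero)       v = refl
  step-rotate-next (suc (suc zero)) v = refl

  colour : Fin 3 → Colour
  colour zero             = X
  colour (suc zero)       = Y
  colour (suc (suc zero)) = Z

  colourIndex : Colour → Fin 3
  colourIndex X = zero
  colourIndex Y = suc zero
  colourIndex Z = suc (suc zero)

  colourIndex-colour : ∀ i → colourIndex (colour i) ≡ i
  colourIndex-colour zero             = refl
  colourIndex-colour (suc zero)       = refl
  colourIndex-colour (suc (suc zero)) = refl

  dirOf : Fin 3 → Vertex n → Fin 3
  dirOf i w with sumIsMinusOne? n w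
  ... | yes _ = next i
  ... | no  _ = i

  colourOf-dirOf : ∀ i w → colourOf n (w , dirOf i w) ≡ colour i
  colourOf-dirOf i w with sumIsMinusOne? n w
  colourOf-dirOf zero             w | yes _ = refl
  colourOf-dirOf (suc zero)       w | yes _ = refl
  colourOf-dirOf (suc (suc zero)) w | yes _ = refl
  colourOf-dirOf zero             w | no  _ = refl
  colourOf-dirOf (suc zero)       w | no  _ = refl
  colourOf-dirOf (suc (suc zero)) w | no  _ = refl

  dirOf-colourOf : ∀ w d → dirOf (colourIndex (colourOf n (w , d))) w ≡ d
  dirOf-colourOf w d with sumIsMinusOne? n w
  dirOf-colourOf w zero             | yes _ = refl
  dirOf-colourOf w (suc zero)       | yes _ = refl
  dirOf-colourOf w (suc (suc zero)) | yes _ = refl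
  dirOf-colourOf w zero             | no  _ = refl
  dirOf-colourOf w (suc zero)       | no  _ = refl
  dirOf-colourOf w (suc (suc zero)) | no  _ = refl

  cycleVertex : Fin 3 → Fin q → ℕ → Vertex n
  cycleVertex i j t = rotate i (odometer j t)

  coordSum-cycleVertex : ∀ i j t → coordSum (cycleVertex i j t) % q ≡ t % q
  coordSum-cycleVertex i j t = trans (cong (_% q) (coordSum-rotate i (odometer j t))) (coordSum-odometer j t)

  step-cycleVertex : ∀ i j t →
    step n (cycleVertex i j t) (dirOf i (cycleVertex i j t)) ≡ cycleVertex i j (suc t)
  step-cycleVertex i j t with sumIsMinusOne? n (cycleVertex i j t)
  ... | yes sum≡-1 = trans (step-rotate-next i (odometer j t))
          (cong (rotate i) (odometer-suc-carry j t (trans (sym (coordSum-cycleVertex i j t)) sum≡-1)))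
  ... | no  sum≢-1 = trans (step-rotate i (odometer j t))
          (cong (rotate i) (odometer-suc j t (λ t≡-1 → sum≢-1 (trans (coordSum-cycleVertex i j t) t≡-1))))

  L : ℕ
  L = 4 ^ (2 * n)

  instance
    L≢0 : NonZero L
    L≢0 = m^n≢0 4 (2 * n)

  L≡q*q : L ≡ q * q
  L≡q*q = trans (cong (4 ^_) (cong (n +_) (+-identityʳ n))) (^-distribˡ-+-* 4 n n)

  edgeFrom : Fin 3 → Vertex n → Edge n
  edgeFrom i w = w , dirOf i w

  cycle : Fin 3 → Fin q → Fin L → Edge n
  cycle i j k = edgeFrom i (cycleVertex i j (toℕ k))

  positionIndex : Vertex n → Fin L
  positionIndex v = fromℕ< (subst (position v <_) (sym L≡q*q) (position<q*q v))

  toℕ-positionIndex : ∀ v → toℕ (positionIndex v) ≡ position v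
  toℕ-positionIndex v = toℕ-fromℕ< _

  positionIndex-odometer : ∀ j k → positionIndex (odometer j (toℕ k)) ≡ k
  positionIndex-odometer j k = toℕ-injective (begin
    toℕ (positionIndex (odometer j (toℕ k))) ≡⟨ toℕ-positionIndex (odometer j (toℕ k)) ⟩
    position (odometer j (toℕ k))            ≡⟨ position-odometer j (subst (toℕ k <_) L≡q*q (toℕ<n k)) ⟩
    toℕ k                                    ∎)

  family : Fin (3 * q) → Fin L → Edge n
  family J = uncurry cycle (remQuot q J)

  decodeFamily : Edge n → Fin (3 * q) × Fin L
  decodeFamily (w , d) = combine i (layer v) , positionIndex v
    where
    i = colourIndex (colourOf n (w , d))
    v = unrotate i w

  decodeFamily-edgeFrom : ∀ i w →
    decodeFamily (edgeFrom i w) ≡ (combine i (layer (unrotate i w)) , positionIndex (unrotate i w))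
  decodeFamily-edgeFrom i w =
    cong (λ i′ → combine i′ (layer (unrotate i′ w)) , positionIndex (unrotate i′ w))
         (trans (cong colourIndex (colourOf-dirOf i w)) (colourIndex-colour i))

  decodeFamily-family : ∀ J k → decodeFamily (family J k) ≡ (J , k)
  decodeFamily-family J k = begin
    decodeFamily (cycle i j k)
      ≡⟨ decodeFamily-edgeFrom i _ ⟩
    (combine i (layer v) , positionIndex v)
      ≡⟨ cong (λ v → combine i (layer v) , positionIndex v) (unrotate-rotate i _) ⟩
    (combine i j , positionIndex (odometer j (toℕ k)))
      ≡⟨ cong₂ _,_ (combine-remQuot {3} q J) (positionIndex-odometer j k) ⟩
    (J , k)
      ∎
    where
    i = proj₁ (remQuot q J)
    j = proj₂ (remQuot q J)
    v = unrotate i (cycleVertex i j (toℕ k))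

  family-decodeFamily : ∀ e → uncurry family (decodeFamily e) ≡ e
  family-decodeFamily (w , d) = begin
    uncurry cycle (remQuot q (combine i (layer v))) (positionIndex v)
      ≡⟨ cong (λ p → uncurry cycle p (positionIndex v)) (remQuot-combine i (layer v)) ⟩
    edgeFrom i (rotate i (odometer (layer v) (toℕ (positionIndex v))))
      ≡⟨ cong (λ t → edgeFrom i (rotate i (odometer (layer v) t))) (toℕ-positionIndex v) ⟩
    edgeFrom i (rotate i (odometer (layer v) (position v)))
      ≡⟨ cong (λ v → edgeFrom i (rotate i v)) (odometer-position v) ⟩
    edgeFrom i (rotate i v) ≡⟨ cong (edgeFrom i) (rotate-unrotate i w) ⟩
    (w , dirOf i w)         ≡⟨ cong (w ,_) (dirOf-colourOf w d) ⟩
    (w , d)                 ∎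
    where
    i = colourIndex (colourOf n (w , d))
    v = unrotate i w

  family-injective : ∀ J k J′ k′ → family J k ≡ family J′ k′ → (J , k) ≡ (J′ , k′)
  family-injective J k J′ k′ eq = begin
    (J , k)                     ≡⟨ decodeFamily-family J k ⟨
    decodeFamily (family J k)   ≡⟨ cong decodeFamily eq ⟩
    decodeFamily (family J′ k′) ≡⟨ decodeFamily-family J′ k′ ⟩
    (J′ , k′)                   ∎

  cycle-isDirectedCycle : ∀ i j → IsDirectedCycle n L (cycle i j)
  cycle-isDirectedCycle i j = consecutive , sources-distinct
    where
    consecutive : ∀ k → target n (cycle i j k) ≡ source n (cycle i j (suc (toℕ k) mod L))
    consecutive k = begin
      target n (cycle i j k)                    ≡⟨ step-cycleVertex i j (toℕ k) ⟩
      cycleVertex i j (suc (toℕ k))             ≡⟨ cong (rotate i) (odometer-mod j (suc (toℕ k))) ⟨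
      cycleVertex i j (suc (toℕ k) % (q * q))   ≡⟨ cong (cycleVertex i j) (%-congʳ (sym L≡q*q)) ⟩
      cycleVertex i j (suc (toℕ k) % L)         ≡⟨ cong (cycleVertex i j) (toℕ-fromℕ< _) ⟨
      cycleVertex i j (toℕ (suc (toℕ k) mod L)) ∎

    sources-distinct : ∀ k l → source n (cycle i j k) ≡ source n (cycle i j l) → k ≡ l
    sources-distinct k l eq = begin
      k
        ≡⟨ positionIndex-odometer j k ⟨
      positionIndex (odometer j (toℕ k))
        ≡⟨ cong positionIndex (unrotate-rotate i _) ⟨
      positionIndex (unrotate i (cycleVertex i j (toℕ k)))
        ≡⟨ cong (positionIndex ∘ unrotate i) eq ⟩
      positionIndex (unrotate i (cycleVertex i j (toℕ l)))
        ≡⟨ cong positionIndex (unrotate-rotate i _) ⟩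
      positionIndex (odometer j (toℕ l))
        ≡⟨ positionIndex-odometer j l ⟩
      l ∎

lemma2 : (n : ℕ) → 1 ≤ n →
    CycleDecomposition n (3 * 4 ^ n) (4 ^ (2 * n)) {{m^n≢0 4 (2 * n)}}
lemma2 n _ =
    family
  , (λ J → uncurry cycle-isDirectedCycle (remQuot q J))
  , (λ J → colour (proj₁ (remQuot q J)) , λ k → colourOf-dirOf (proj₁ (remQuot q J)) _)
  , family-injective
  , (λ e → proj₁ (decodeFamily e) , proj₂ (decodeFamily e) , family-decodeFamily e)
  where open Torus n
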